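{- Let $e$ be a hyperedge with $r$ nodes, $q=\lfloor r/2\rfloor$, and let $\mathbf{w}_e$ be a cardinality-based submodular splitting function on $e$ with penalties $w_i$ ($\mathbf{w}_e(S)=w_i$ when $\min\{|S|,|e\setminus S|\}=i$, $1\le i\le q$). Then $2w_1\ge w_2$; $2w_j\ge w_{j-1}+w_{j+1}$ for $j=2,\dots,q-1$; and $0\le w_1\le w_2\le\cdots\le w_q$ (each inequality asserted whenever all its indices lie in $\{1,\dots,q\}$).
   Context: A splitting function on a finite set $e$ is $\mathbf{w}_e:2^e\to\mathbb{R}$ with $\mathbf{w}_e(S)\ge0$, $\mathbf{w}_e(S)=\mathbf{w}_e(e\setminus S)$ for all $S\subseteq e$, and $\mathbf{w}_e(e)=\mathbf{w}_e(\emptyset)=0$. It is cardinality-based if $\mathbf{w}_e(S_1)=\mathbf{w}_e(S_2)$ whenever $|S_1|=|S_2|$, and submodular if $\mathbf{w}_e(S_1)+\mathbf{w}_e(S_2)\ge\mathbf{w}_e(S_1\cap S_2)+\mathbf{w}_e(S_1\cup S_2)$ for all $S_1,S_2\subseteq e$. -}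

module Defs where

open import Level using (Level; _⊔_) renaming (suc to lsuc)
open import Algebra.Bundles using (AbelianGroup)
open import Relation.Binary.Core using (Rel)
open import Relation.Binary.Structures using (IsTotalOrder)
open import Relation.Binary.PropositionalEquality using (_≡_)
open import Data.Nat using (ℕ)
open import Data.Fin.Subset using (Subset; ⊥; ⊤; ∁; _∩_; _∪_; ∣_∣)

-- The paper's splitting functions take values in ℝ.  The standard library has
-- no reals, so we work over an arbitrary totally ordered abelian group
-- (ℝ with +, 0 and ≤ is an instance).
record TotallyOrderedAbelianGroup (c ℓ₁ ℓ₂ : Level) : Set (lsuc (c ⊔ ℓ₁ ⊔ ℓ₂)) where
  field
    abelianGroup : AbelianGroup c ℓ₁
  open AbelianGroup abelianGroup public
  field
    _≤_          : Rel Carrier ℓ₂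
    isTotalOrder : IsTotalOrder _≈_ _≤_
    ∙-monoˡ-≤    : ∀ z {x y} → x ≤ y → (x ∙ z) ≤ (y ∙ z)

module _ {c ℓ₁ ℓ₂ : Level} (G : TotallyOrderedAbelianGroup c ℓ₁ ℓ₂) where
  open TotallyOrderedAbelianGroup G

  -- A hyperedge e with r nodes is modelled as Fin r; subsets of e are Subset r.

  record IsSplittingFunction {r : ℕ} (w : Subset r → Carrier) : Set (c ⊔ ℓ₁ ⊔ ℓ₂) where
    field
      nonneg    : ∀ S → ε ≤ w S
      symmetric : ∀ S → w S ≈ w (∁ S)
      full-zero : w ⊤ ≈ ε
      empty-zero : w ⊥ ≈ ε

  IsCardinalityBased : {r : ℕ} → (Subset r → Carrier) → Set ℓ₁
  IsCardinalityBased {r} w = ∀ (S₁ S₂ : Subset r) → ∣ S₁ ∣ ≡ ∣ S₂ ∣ → w S₁ ≈ w S₂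

  IsSubmodular : {r : ℕ} → (Subset r → Carrier) → Set ℓ₂
  IsSubmodular {r} w = ∀ (S₁ S₂ : Subset r) → (w (S₁ ∩ S₂) ∙ w (S₁ ∪ S₂)) ≤ (w S₁ ∙ w S₂)

module Submission where

-- Write r = 1 + r' and let g(k) be the value of w on any k-element
-- subset of e (well defined since w is cardinality-based).  Take nested prefix
-- sets P_a ⊆ P_b of the last r' nodes (a ≤ b ≤ r') and apply submodularity to
-- A = {first node} ∪ P_a and B = P_b: then A ∩ B = P_a and A ∪ B = {first} ∪ P_b,
-- which yields the discrete concavity of the profile
--     g(a) + g(b + 1) ≤ g(a + 1) + g(b)        (a ≤ b ≤ r').
-- The penalties are pen i = g(i) = g(r - i) for 1 ≤ i ≤ ⌊r/2⌋.  The four claims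
-- then follow: a = 0, b = 1 gives 2w₁ ≥ w₂ (as g(0) = w(∅) = 0); a = j-1, b = j
-- gives 2w_j ≥ w_{j-1} + w_{j+1}; nonnegativity of w gives w₁ ≥ 0; and the
-- "long" instance a = j, b = r' - j gives 2w_j ≤ 2w_{j+1}, from which w_j ≤ w_{j+1}
-- because doubling reflects ≤ in a totally ordered abelian group.

open import Defs
open import Level using (Level)
open import Data.Nat using (ℕ; suc; _≤_; _∸_; _/_; _⊓_)
open import Data.Fin.Subset using (Subset; ∣_∣)
open import Data.Product using (_×_)
open import Relation.Binary.PropositionalEquality using (_≡_)

open import Data.Nat using (zero; _+_; _⊔_; z≤n; s≤s)
import Data.Nat.Properties as ℕₚ
open import Data.Nat.DivMod using (m/n*n≤m; m/n<m)
open import Data.Fin.Subset using (inside; outside; _∩_; _∪_; ⊥)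
open import Data.Fin.Subset.Properties using (∣p∣≤n; ∣⊥∣≡0)
open import Data.Vec using ([]; _∷_)
open import Data.Product using (_,_)
open import Data.Sum using (inj₁; inj₂)
open import Relation.Binary.PropositionalEquality using (refl; cong; subst; subst₂)
  renaming (sym to ≡-sym; trans to ≡-trans)
open import Relation.Binary.Structures using (IsTotalOrder)
open import Function using (_∘_)

module OrderedGroupFacts {c ℓ₁ ℓ₂ : Level} (G : TotallyOrderedAbelianGroup c ℓ₁ ℓ₂) where
  open TotallyOrderedAbelianGroup G renaming (_≤_ to _≤ᴳ_)
  open IsTotalOrder isTotalOrder using (total) renaming (trans to ≤-trans; reflexive to ≤-reflexive)

  ≤-resp-≈ : ∀ {x x′ y y′} → x ≈ x′ → y ≈ y′ → x ≤ᴳ y → x′ ≤ᴳ y′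
  ≤-resp-≈ x≈x′ y≈y′ x≤y = ≤-trans (≤-reflexive (sym x≈x′)) (≤-trans x≤y (≤-reflexive y≈y′))

  ∙-≤-resp-≈ : ∀ {a a′ b b′ c c′ d d′} → a ≈ a′ → b ≈ b′ → c ≈ c′ → d ≈ d′ →
               (a ∙ b) ≤ᴳ (c ∙ d) → (a′ ∙ b′) ≤ᴳ (c′ ∙ d′)
  ∙-≤-resp-≈ a≈ b≈ c≈ d≈ = ≤-resp-≈ (∙-cong a≈ b≈) (∙-cong c≈ d≈)

  ∙-monoʳ-≤ : ∀ z {x y} → x ≤ᴳ y → (z ∙ x) ≤ᴳ (z ∙ y)
  ∙-monoʳ-≤ z x≤y = ≤-resp-≈ (comm _ z) (comm _ z) (∙-monoˡ-≤ z x≤y)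

  ∙-cancelʳ-≤ : ∀ {x y z} → (x ∙ z) ≤ᴳ (y ∙ z) → x ≤ᴳ y
  ∙-cancelʳ-≤ {x} {y} {z} = ≤-resp-≈ (remove-z x) (remove-z y) ∘ ∙-monoˡ-≤ (z ⁻¹)
    where
    remove-z : ∀ u → ((u ∙ z) ∙ z ⁻¹) ≈ u
    remove-z u = trans (assoc u z (z ⁻¹)) (trans (∙-congˡ (inverseʳ z)) (identityʳ u))

  double-reflects-≤ : ∀ {x y} → (x ∙ x) ≤ᴳ (y ∙ y) → x ≤ᴳ y
  double-reflects-≤ {x} {y} xx≤yy with total x y
  ... | inj₁ x≤y = x≤y
  ... | inj₂ y≤x = ∙-cancelʳ-≤ (≤-trans xx≤yy (∙-monoʳ-≤ y y≤x))

-- The prefix set of the first k of n nodes (all n nodes if k ≥ n).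
prefix : (n k : ℕ) → Subset n
prefix zero    k       = []
prefix (suc n) zero    = outside ∷ prefix n zero
prefix (suc n) (suc k) = inside ∷ prefix n k

∣prefix∣ : ∀ n k → k ≤ n → ∣ prefix n k ∣ ≡ k
∣prefix∣ zero    .zero   z≤n       = refl
∣prefix∣ (suc n) zero    _         = ∣prefix∣ n zero z≤n
∣prefix∣ (suc n) (suc k) (s≤s k≤n) = cong suc (∣prefix∣ n k k≤n)

prefix-∩ : ∀ n a b → prefix n a ∩ prefix n b ≡ prefix n (a ⊓ b)
prefix-∩ zero    a       b       = refl
prefix-∩ (suc n) zero    zero    = cong (outside ∷_) (prefix-∩ n zero zero)
prefix-∩ (suc n) zero    (suc b) = cong (outside ∷_) (prefix-∩ n zero b)
prefix-∩ (suc n) (suc a) zero    =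
  cong (outside ∷_) (≡-trans (prefix-∩ n a zero) (cong (prefix n) (ℕₚ.⊓-zeroʳ a)))
prefix-∩ (suc n) (suc a) (suc b) = cong (inside ∷_) (prefix-∩ n a b)

prefix-∪ : ∀ n a b → prefix n a ∪ prefix n b ≡ prefix n (a ⊔ b)
prefix-∪ zero    a       b       = refl
prefix-∪ (suc n) zero    zero    = cong (outside ∷_) (prefix-∪ n zero zero)
prefix-∪ (suc n) zero    (suc b) = cong (inside ∷_) (prefix-∪ n zero b)
prefix-∪ (suc n) (suc a) zero    =
  cong (inside ∷_) (≡-trans (prefix-∪ n a zero) (cong (prefix n) (ℕₚ.⊔-identityʳ a)))
prefix-∪ (suc n) (suc a) (suc b) = cong (inside ∷_) (prefix-∪ n a b)

-- Arithmetic of ⌊r/2⌋: an index i ≤ ⌊r/2⌋ satisfies i + i ≤ r, so that i is the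
-- smaller side both of an i-set and of an (r - i)-set.
double-≤ : ∀ r i → i ≤ r / 2 → i + i ≤ r
double-≤ r i i≤r/2 = subst (_≤ r) i*2≡i+i (ℕₚ.≤-trans (ℕₚ.*-monoˡ-≤ 2 i≤r/2) (m/n*n≤m r 2))
  where i*2≡i+i = ≡-trans (ℕₚ.*-comm i 2) (cong (i +_) (ℕₚ.+-identityʳ i))

min-small-side : ∀ r i → i ≤ r / 2 → i ⊓ (r ∸ i) ≡ i
min-small-side r i i≤r/2 = ℕₚ.m≤n⇒m⊓n≡m (ℕₚ.m+n≤o⇒m≤o∸n i (double-≤ r i i≤r/2))

min-large-side : ∀ r i → i ≤ r / 2 → (r ∸ i) ⊓ (r ∸ (r ∸ i)) ≡ i
min-large-side r i i≤r/2 = ≡-trans (cong ((r ∸ i) ⊓_) (ℕₚ.m∸[m∸n]≡n i≤r))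
                                   (ℕₚ.m≥n⇒m⊓n≡n (ℕₚ.m+n≤o⇒m≤o∸n i (double-≤ r i i≤r/2)))
  where i≤r = ℕₚ.m+n≤o⇒n≤o i (double-≤ r i i≤r/2)

half-≤-pred : ∀ r′ → suc r′ / 2 ≤ r′
half-≤-pred r′ = ℕₚ.≤-pred (m/n<m (suc r′) 2 (s≤s (s≤s z≤n)))

module Profile {c ℓ₁ ℓ₂ : Level} (G : TotallyOrderedAbelianGroup c ℓ₁ ℓ₂)
  (r′ : ℕ) (w : Subset (suc r′) → TotallyOrderedAbelianGroup.Carrier G)
  (split : IsSplittingFunction G w) (card : IsCardinalityBased G w) (submod : IsSubmodular G w)
  where
  open TotallyOrderedAbelianGroup G renaming (_≤_ to _≤ᴳ_; refl to ≈-refl)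
  open OrderedGroupFacts G
  open IsSplittingFunction split using (nonneg; empty-zero)

  r : ℕ
  r = suc r′

  profile : ℕ → Carrier
  profile k = w (prefix r k)

  profile-≡ : ∀ {k l} → k ≡ l → profile k ≈ profile l
  profile-≡ refl = ≈-refl

  w-of-size : ∀ S {k} → ∣ S ∣ ≡ k → w S ≈ profile k
  w-of-size S refl = card S (prefix r ∣ S ∣) (≡-sym (∣prefix∣ r ∣ S ∣ (∣p∣≤n S)))

  profile-zero : profile 0 ≈ ε
  profile-zero = trans (sym (w-of-size ⊥ (∣⊥∣≡0 r))) empty-zero

  -- Submodularity on A = {first} ∪ P_a and B = P_b, where A ∩ B = P_a and
  -- A ∪ B = {first} ∪ P_b because the prefixes P_a ⊆ P_b are nested.
  profile-concave : ∀ {a b} → a ≤ b → b ≤ r′ →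
                    (profile a ∙ profile (suc b)) ≤ᴳ (profile (suc a) ∙ profile b)
  profile-concave {a} {b} a≤b b≤r′ =
    ∙-≤-resp-≈ (w-of-size _ (∣prefix∣ r′ a a≤r′)) (w-of-size _ (cong suc (∣prefix∣ r′ b b≤r′)))
               (w-of-size _ (cong suc (∣prefix∣ r′ a a≤r′))) (w-of-size _ (∣prefix∣ r′ b b≤r′))
               submod-on-prefixes
    where
    a≤r′ = ℕₚ.≤-trans a≤b b≤r′
    A = inside ∷ prefix r′ a
    B = outside ∷ prefix r′ b
    meet : prefix r′ a ∩ prefix r′ b ≡ prefix r′ a
    meet = ≡-trans (prefix-∩ r′ a b) (cong (prefix r′) (ℕₚ.m≤n⇒m⊓n≡m a≤b))
    join : prefix r′ a ∪ prefix r′ b ≡ prefix r′ b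
    join = ≡-trans (prefix-∪ r′ a b) (cong (prefix r′) (ℕₚ.m≤n⇒m⊔n≡n a≤b))
    submod-on-prefixes : (w (outside ∷ prefix r′ a) ∙ w (inside ∷ prefix r′ b)) ≤ᴳ (w A ∙ w B)
    submod-on-prefixes =
      subst₂ (λ X Y → (w (outside ∷ X) ∙ w (inside ∷ Y)) ≤ᴳ (w A ∙ w B)) meet join (submod A B)

  module Penalties (pen : ℕ → Carrier)
    (pen-spec : ∀ (S : Subset r) (i : ℕ) → 1 ≤ i → i ≤ r / 2 → (∣ S ∣ ⊓ (r ∸ ∣ S ∣)) ≡ i → w S ≈ pen i)
    where

    profile≈pen : ∀ {i} → 1 ≤ i → i ≤ r / 2 → profile i ≈ pen i
    profile≈pen {i} 1≤i i≤r/2 = pen-spec (prefix r i) i 1≤i i≤r/2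
      (≡-trans (cong (λ k → k ⊓ (r ∸ k)) (∣prefix∣ r i (ℕₚ.m+n≤o⇒n≤o i (double-≤ r i i≤r/2))))
               (min-small-side r i i≤r/2))

    complement-profile≈pen : ∀ {i} → 1 ≤ i → i ≤ r / 2 → profile (r ∸ i) ≈ pen i
    complement-profile≈pen {i} 1≤i i≤r/2 = pen-spec (prefix r (r ∸ i)) i 1≤i i≤r/2
      (≡-trans (cong (λ k → k ⊓ (r ∸ k)) (∣prefix∣ r (r ∸ i) (ℕₚ.m∸n≤m r i)))
               (min-large-side r i i≤r/2))

    -- 2w₁ ≥ w₂: concavity at a = 0, b = 1, with g(0) = 0.
    pen-2≤pen-1∙pen-1 : 2 ≤ r / 2 → pen 2 ≤ᴳ (pen 1 ∙ pen 1)
    pen-2≤pen-1∙pen-1 2≤r/2 =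
      ≤-resp-≈ (trans (∙-cong profile-zero (profile≈pen (s≤s z≤n) 2≤r/2)) (identityˡ (pen 2)))
               (∙-cong pen-1 pen-1)
               (profile-concave z≤n (ℕₚ.≤-trans (s≤s z≤n) (ℕₚ.≤-trans 2≤r/2 (half-≤-pred r′))))
      where pen-1 = profile≈pen (s≤s z≤n) (ℕₚ.≤-trans (s≤s z≤n) 2≤r/2)

    -- 2w_j ≥ w_{j-1} + w_{j+1}: concavity at a = j - 1, b = j.
    pen-concave : ∀ j → 2 ≤ j → suc j ≤ r / 2 → (pen (j ∸ 1) ∙ pen (suc j)) ≤ᴳ (pen j ∙ pen j)
    pen-concave (suc a) (s≤s 1≤a) 2+a≤r/2 =
      ∙-≤-resp-≈ (profile≈pen 1≤a a≤r/2) (profile≈pen (s≤s z≤n) 2+a≤r/2)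
                 (profile≈pen (s≤s z≤n) 1+a≤r/2) (profile≈pen (s≤s z≤n) 1+a≤r/2)
                 (profile-concave (ℕₚ.n≤1+n a)
                   (ℕₚ.≤-trans (ℕₚ.n≤1+n (suc a)) (ℕₚ.≤-trans 2+a≤r/2 (half-≤-pred r′))))
      where
      1+a≤r/2 = ℕₚ.≤-trans (ℕₚ.n≤1+n (suc a)) 2+a≤r/2
      a≤r/2   = ℕₚ.≤-trans (ℕₚ.n≤1+n a) 1+a≤r/2

    pen-1-nonneg : 1 ≤ r / 2 → ε ≤ᴳ pen 1
    pen-1-nonneg 1≤r/2 = ≤-resp-≈ ≈-refl (profile≈pen (s≤s z≤n) 1≤r/2) (nonneg (prefix r 1))

    -- w_j ≤ w_{j+1}: concavity at a = j, b = r' - j reads g(j) + g(r - j) ≤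
    -- g(j + 1) + g(r - (j + 1)), i.e. 2w_j ≤ 2w_{j+1}.
    pen-mono : ∀ j → 1 ≤ j → suc j ≤ r / 2 → pen j ≤ᴳ pen (suc j)
    pen-mono j 1≤j 1+j≤r/2 = double-reflects-≤
      (∙-≤-resp-≈ (profile≈pen 1≤j j≤r/2)
                  (trans (profile-≡ (≡-sym (ℕₚ.+-∸-assoc 1 j≤r′))) (complement-profile≈pen 1≤j j≤r/2))
                  (profile≈pen (s≤s z≤n) 1+j≤r/2) (complement-profile≈pen (s≤s z≤n) 1+j≤r/2)
                  (profile-concave j≤r′∸j (ℕₚ.m∸n≤m r′ j)))
      where
      j≤r/2 = ℕₚ.≤-trans (ℕₚ.n≤1+n j) 1+j≤r/2
      j+j≤r′ : j + j ≤ r′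
      j+j≤r′ = ℕₚ.≤-trans (ℕₚ.+-monoʳ-≤ j (ℕₚ.n≤1+n j)) (ℕₚ.≤-pred (double-≤ r (suc j) 1+j≤r/2))
      j≤r′∸j = ℕₚ.m+n≤o⇒m≤o∸n j j+j≤r′
      j≤r′   = ℕₚ.m+n≤o⇒n≤o j j+j≤r′

-- Lemma 4.5.  For r = 0 all claims are vacuous since ⌊0/2⌋ = 0.
lemma4p5 : ∀ {c ℓ₁ ℓ₂ : Level} (G : TotallyOrderedAbelianGroup c ℓ₁ ℓ₂) →
    let open TotallyOrderedAbelianGroup G renaming (_≤_ to _≤ᴳ_) in
    (r : ℕ) (w : Subset r → Carrier) (pen : ℕ → Carrier) →
    IsSplittingFunction G w → IsCardinalityBased G w → IsSubmodular G w →
    (∀ (S : Subset r) (i : ℕ) → 1 ≤ i → i ≤ r / 2 → (∣ S ∣ ⊓ (r ∸ ∣ S ∣)) ≡ i → w S ≈ pen i) →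
    ((2 ≤ r / 2 → pen 2 ≤ᴳ (pen 1 ∙ pen 1))
    × (∀ j → 2 ≤ j → suc j ≤ r / 2 → (pen (j ∸ 1) ∙ pen (suc j)) ≤ᴳ (pen j ∙ pen j))
    × (1 ≤ r / 2 → ε ≤ᴳ pen 1)
    × (∀ j → 1 ≤ j → suc j ≤ r / 2 → pen j ≤ᴳ pen (suc j)))
lemma4p5 G zero w pen split card submod pen-spec = (λ ()) , (λ _ _ ()) , (λ ()) , (λ _ _ ())
lemma4p5 G (suc r′) w pen split card submod pen-spec =
  pen-2≤pen-1∙pen-1 , pen-concave , pen-1-nonneg , pen-mono
  where open Profile.Penalties G r′ w split card submod pen pen-spec
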